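{- Let $\delta = \lceil k/3\rceil$ and let $G$ be an $n$-vertex $u$-uniform $k$-circle-layered hypergraph with parts $V_1,\ldots,V_k$. If $k > \gamma_3^{ -1}(u)$, then for every $i \in [1,k]$, every hyperedge of $G$ contains vertices from at most two of the three parts $V_i, V_{i+\delta}, V_{i+2\delta}$ (indices taken modulo $k$).
   Context: $\gamma_3(k) = k - \lceil k/3\rceil + 1$ and $\gamma_3^{ -1}(u) = \max\{k : \gamma_3(k)=u\}$. A $u$-uniform hypergraph is $k$-circle-layered (with $u\le k$) if its vertex set is partitioned into $V_1,\ldots,V_k$, arranged in a circle, and every hyperedge consists of exactly one vertex from each of $u$ cyclically consecutive parts $V_i, V_{i+1 \bmod k}, \ldots, V_{i+u-1 \bmod k}$. -}

module Defs where

open import Data.Nat using (ℕ; zero; suc; _+_; _*_; _∸_; _≤_; _<_; NonZero)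
open import Data.Nat.DivMod using (_/_; _mod_)
open import Data.Fin using (Fin; toℕ)
open import Data.Fin.Subset using (Subset; _∈_; ∣_∣)
open import Data.Product using (Σ; ∃; _×_)
open import Relation.Binary.PropositionalEquality using (_≡_)

⌈_/3⌉ : ℕ → ℕ
⌈ k /3⌉ = (k + 2) / 3

γ₃ : ℕ → ℕ
γ₃ k = k ∸ ⌈ k /3⌉ + 1

IsGamma3Inv : ℕ → ℕ → Set
IsGamma3Inv u m = (γ₃ m ≡ u) × (∀ m′ → γ₃ m′ ≡ u → m′ ≤ m)

_⊕_ : ∀ {k} .{{_ : NonZero k}} → Fin k → ℕ → Fin k
_⊕_ {k} i j = (toℕ i + j) mod k

-- A u-uniform k-circle-layered hypergraph on vertex set Fin n.
-- part v = index of the part containing v (so the parts partition the vertex set).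
record CircleLayered (n k u : ℕ) .{{_ : NonZero k}} : Set₁ where
  field
    part  : Fin n → Fin k
    Edge  : Subset n → Set
    uniform : ∀ e → Edge e → ∣ e ∣ ≡ u
    layered : ∀ e → Edge e → Σ (Fin k) λ i →
      (∀ v → v ∈ e → Σ ℕ λ j → (j < u) × (part v ≡ i ⊕ j)) ×
      (∀ j → j < u → Σ (Fin n) λ v → (v ∈ e) × (part v ≡ i ⊕ j) ×
          (∀ w → w ∈ e → part w ≡ i ⊕ j → w ≡ v))

  Meets : Subset n → Fin k → Set
  Meets e p = ∃ λ v → (v ∈ e) × (part v ≡ p)

{-# OPTIONS --safe #-}
-- An edge occupies an arc of u cyclically consecutive parts; measure every part by its
-- forward offset from the first part of that arc.  Maximality of m = γ₃⁻¹(u) < k and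
-- monotonicity of γ₃ give γ₃(k) > u, i.e. u + ⌈k/3⌉ ≤ k.  Hence a step of δ = ⌈k/3⌉ from
-- inside the arc never wraps around the circle, so if the offsets x, x + δ, x + 2δ (mod k)
-- of V_i, V_{i+δ}, V_{i+2δ} all lay in the arc they would be x + δ + δ < u, forcing
-- x + 3δ < u + δ ≤ k ≤ 3δ.
module Submission where

open import Defs
open import Data.Nat using (ℕ; zero; suc; _+_; _*_; _∸_; _≤_; _<_; _≤′_; ≤′-refl; ≤′-step; z≤n; s≤s; s≤s⁻¹; NonZero)
open import Data.Nat.Properties
open import Data.Nat.DivMod
open import Data.Nat.Tactic.RingSolver using (solve-∀)
open import Data.Fin using (Fin; toℕ)
open import Data.Fin.Properties using (toℕ≤n; toℕ-fromℕ<)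
open import Data.Fin.Subset using (Subset)
open import Data.Product using (Σ; _×_; _,_; proj₁)
open import Algebra.Properties.CommutativeSemigroup +-commutativeSemigroup using (xy∙z≈y∙xz; xy∙z≈xz∙y)
open import Function using (_∘_)
open import Relation.Binary.PropositionalEquality
open import Relation.Nullary using (¬_)
open import Data.Empty using (⊥)

⌈suc/3⌉ : ∀ n → ⌈ suc n /3⌉ ≡ suc (n / 3)
⌈suc/3⌉ n = trans (/-congˡ {o = 3} (+-comm (suc n) 2)) (m/n≡1+[m∸n]/n (m≤m+n 3 n))

⌈n/3⌉≤n : ∀ n → ⌈ n /3⌉ ≤ n
⌈n/3⌉≤n zero = z≤n
⌈n/3⌉≤n (suc n) rewrite ⌈suc/3⌉ n = s≤s (m/n≤m n 3)

n≤3*⌈n/3⌉ : ∀ n → n ≤ 3 * ⌈ n /3⌉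
n≤3*⌈n/3⌉ n = +-cancelʳ-≤ 2 n (3 * ⌈ n /3⌉) (begin
  n + 2                           ≡⟨ m≡m%n+[m/n]*n (n + 2) 3 ⟩
  (n + 2) % 3 + ⌈ n /3⌉ * 3        ≤⟨ +-mono-≤ (s≤s⁻¹ (m%n<n (n + 2) 3)) (≤-reflexive (*-comm ⌈ n /3⌉ 3)) ⟩
  2 + 3 * ⌈ n /3⌉                  ≡⟨ +-comm 2 (3 * ⌈ n /3⌉) ⟩
  3 * ⌈ n /3⌉ + 2                  ∎)
  where open ≤-Reasoning

γ₃-suc-mono : ∀ n → γ₃ n ≤ γ₃ (suc n)
γ₃-suc-mono n rewrite ⌈suc/3⌉ n = +-monoˡ-≤ 1 (∸-monoʳ-≤ n (/-monoˡ-≤ 3 (m≤m+n n 2)))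

γ₃-mono : ∀ {m n} → m ≤ n → γ₃ m ≤ γ₃ n
γ₃-mono = γ₃-mono′ ∘ ≤⇒≤′
  where
  γ₃-mono′ : ∀ {m n} → m ≤′ n → γ₃ m ≤ γ₃ n
  γ₃-mono′ ≤′-refl                = ≤-refl
  γ₃-mono′ (≤′-step {n = n} m≤′n) = ≤-trans (γ₃-mono′ m≤′n) (γ₃-suc-mono n)

γ₃⁻¹<k⇒u+⌈k/3⌉≤k : ∀ {u m k} → IsGamma3Inv u m → m < k → u + ⌈ k /3⌉ ≤ k
γ₃⁻¹<k⇒u+⌈k/3⌉≤k {u} {m} {k} (γ₃m≡u , maximal) m<k = begin
  u + ⌈ k /3⌉           ≤⟨ +-monoˡ-≤ ⌈ k /3⌉ u≤k∸⌈k/3⌉ ⟩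
  k ∸ ⌈ k /3⌉ + ⌈ k /3⌉ ≡⟨ m∸n+n≡m (⌈n/3⌉≤n k) ⟩
  k                     ∎
  where
  open ≤-Reasoning
  u<γ₃k : u < γ₃ k
  u<γ₃k = ≤∧≢⇒< (subst (_≤ γ₃ k) γ₃m≡u (γ₃-mono (<⇒≤ m<k)))
                (λ u≡γ₃k → <⇒≱ m<k (maximal k (sym u≡γ₃k)))
  u≤k∸⌈k/3⌉ : u ≤ k ∸ ⌈ k /3⌉
  u≤k∸⌈k/3⌉ = s≤s⁻¹ (subst (u <_) (+-comm (k ∸ ⌈ k /3⌉) 1) u<γ₃k)

module _ {k} .{{_ : NonZero k}} where

  open ≡-Reasoning

  [m%k+n]%k≡[m+n]%k : ∀ m n → (m % k + n) % k ≡ (m + n) % k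
  [m%k+n]%k≡[m+n]%k m n = begin
    (m % k + n) % k          ≡⟨ %-distribˡ-+ (m % k) n k ⟩
    (m % k % k + n % k) % k  ≡⟨ cong (λ t → (t + n % k) % k) (m%n%n≡m%n m k) ⟩
    (m % k + n % k) % k      ≡⟨ %-distribˡ-+ m n k ⟨
    (m + n) % k              ∎

  toℕ-⊕ : ∀ (i : Fin k) j → toℕ (i ⊕ j) ≡ (toℕ i + j) % k
  toℕ-⊕ i j = toℕ-fromℕ< (m%n<n (toℕ i + j) k)

  -- The forward distance from part s to part p; adding k ∸ s rather than subtracting s
  -- avoids truncated subtraction.
  offset : Fin k → Fin k → ℕ
  offset s p = (toℕ p + (k ∸ toℕ s)) % k

  offset-⊕ : ∀ s {j} → j < k → offset s (s ⊕ j) ≡ j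
  offset-⊕ s {j} j<k = begin
    (toℕ (s ⊕ j) + (k ∸ toℕ s)) % k          ≡⟨ cong (λ t → (t + (k ∸ toℕ s)) % k) (toℕ-⊕ s j) ⟩
    ((toℕ s + j) % k + (k ∸ toℕ s)) % k      ≡⟨ [m%k+n]%k≡[m+n]%k (toℕ s + j) (k ∸ toℕ s) ⟩
    (toℕ s + j + (k ∸ toℕ s)) % k            ≡⟨ %-congˡ (wrap (toℕ≤n s)) ⟩
    (j + k) % k                              ≡⟨ [m+n]%n≡m%n j k ⟩
    j % k                                    ≡⟨ m<n⇒m%n≡m j<k ⟩
    j                                        ∎
    where
    wrap : ∀ {a} → a ≤ k → a + j + (k ∸ a) ≡ j + k
    wrap {a} a≤k = trans (xy∙z≈y∙xz a j (k ∸ a)) (cong (j +_) (m+[n∸m]≡n a≤k))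

  offset-⊕-shift : ∀ s p r → offset s (p ⊕ r) ≡ (offset s p + r) % k
  offset-⊕-shift s p r = begin
    (toℕ (p ⊕ r) + c) % k       ≡⟨ cong (λ t → (t + c) % k) (toℕ-⊕ p r) ⟩
    ((toℕ p + r) % k + c) % k   ≡⟨ [m%k+n]%k≡[m+n]%k (toℕ p + r) c ⟩
    (toℕ p + r + c) % k         ≡⟨ %-congˡ (xy∙z≈xz∙y (toℕ p) r c) ⟩
    (toℕ p + c + r) % k         ≡⟨ [m%k+n]%k≡[m+n]%k (toℕ p + c) r ⟨
    ((toℕ p + c) % k + r) % k   ∎
    where c = k ∸ toℕ s

  arc-misses-progression : ∀ {u δ x} → u + δ ≤ k → k ≤ 3 * δ →
    x < u → (x + δ) % k < u → (x + 2 * δ) % k < u → ⊥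
  arc-misses-progression {u} {δ} {x} u+δ≤k k≤3δ x<u [x+δ]%k<u [x+2δ]%k<u =
    <⇒≱ x+δ+δ+δ<k (≤-trans k≤3δ (≤-trans (m≤m+n (3 * δ) x) (≤-reflexive (3δ+x≡x+δ+δ+δ x δ))))
    where
    no-wrap : ∀ {y} → y < u → (y + δ) % k ≡ y + δ
    no-wrap y<u = m<n⇒m%n≡m (<-≤-trans (+-monoˡ-< δ y<u) u+δ≤k)
    x+2δ≡x+δ+δ : ∀ x δ → x + 2 * δ ≡ x + δ + δ
    x+2δ≡x+δ+δ = solve-∀
    3δ+x≡x+δ+δ+δ : ∀ x δ → 3 * δ + x ≡ x + δ + δ + δ
    3δ+x≡x+δ+δ+δ = solve-∀
    x+δ<u : x + δ < u
    x+δ<u = subst (_< u) (no-wrap x<u) [x+δ]%k<u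
    x+δ+δ<u : x + δ + δ < u
    x+δ+δ<u = subst (_< u) (trans (%-congˡ (x+2δ≡x+δ+δ x δ)) (no-wrap x+δ<u)) [x+2δ]%k<u
    x+δ+δ+δ<k : x + δ + δ + δ < k
    x+δ+δ+δ<k = <-≤-trans (+-monoˡ-< δ x+δ+δ<u) u+δ≤k

module _ {n k u} .{{_ : NonZero k}} (G : CircleLayered n k u) where

  open CircleLayered G

  arcStart : ∀ {e} → Edge e → Fin k
  arcStart {e} E = proj₁ (layered e E)

  Meets⇒offset<u : u ≤ k → ∀ {e p} (E : Edge e) → Meets e p → offset (arcStart E) p < u
  Meets⇒offset<u u≤k {e} {p} E (v , v∈e , part-v≡p) with layered e E
  ... | s , inArc , _ with inArc v v∈e
  ... | j , j<u , part-v≡s⊕j = subst (_< u) j≡offset j<u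
    where
    j≡offset : j ≡ offset s p
    j≡offset = begin
      j                ≡⟨ offset-⊕ s (<-≤-trans j<u u≤k) ⟨
      offset s (s ⊕ j) ≡⟨ cong (offset s) (trans (sym part-v≡s⊕j) part-v≡p) ⟩
      offset s p       ∎
      where open ≡-Reasoning

mainTheorem11 : (n k u : ℕ) .{{_ : NonZero k}} → u ≤ k → (G : CircleLayered n k u) →
    Σ ℕ (λ m → IsGamma3Inv u m × m < k) →
    ∀ (i : Fin k) (e : Subset n) → CircleLayered.Edge G e →
      ¬ (CircleLayered.Meets G e i × CircleLayered.Meets G e (i ⊕ ⌈ k /3⌉) ×
         CircleLayered.Meets G e (i ⊕ (2 * ⌈ k /3⌉)))
mainTheorem11 n k u u≤k G (m , isInv , m<k) i e E (meets-i , meets-i+δ , meets-i+2δ) =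
  arc-misses-progression (γ₃⁻¹<k⇒u+⌈k/3⌉≤k isInv m<k) (n≤3*⌈n/3⌉ k)
    (offset<u meets-i) (shifted-offset<u δ meets-i+δ) (shifted-offset<u (2 * δ) meets-i+2δ)
  where
  δ = ⌈ k /3⌉
  s = arcStart G E
  offset<u : ∀ {p} → CircleLayered.Meets G e p → offset s p < u
  offset<u = Meets⇒offset<u G u≤k E
  shifted-offset<u : ∀ r → CircleLayered.Meets G e (i ⊕ r) → (offset s i + r) % k < u
  shifted-offset<u r = subst (_< u) (offset-⊕-shift s i r) ∘ offset<u
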